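{- Let $k\ge1$, $w\in W_\mathcal{A}^k$, and nonnegative integers $i,j$ with $i+j\le k$. Then $\theta_L^{\,i}\theta_R^{\,j}w\in W_\mathcal{A}^{k-i-j}$. Moreover, for any nonnegative integers $i,j,i',j'$ with $i+j=i'+j'\le k$, $\theta_L^{\,i}\theta_R^{\,j}w=\theta_L^{\,i'}\theta_R^{\,j'}w$.
   Context: $\mathcal{A}$ is a finite alphabet with $q$ letters, $V_\mathcal{A}=\mathbb{C}^q$ with standard basis $\{e_a\}$, $V_\mathcal{A}^m$ its $m$-fold tensor power, $V_\mathcal{A}^0=\mathbb{C}$. $f_0=q^{ -1/2}\sum_a e_a$. For $m\ge1$, $\theta_L,\theta_R:V_\mathcal{A}^m\to V_\mathcal{A}^{m-1}$ are linear with $\theta_L(v_1\otimes\cdots\otimes v_m)=\langle f_0,v_1\rangle v_2\otimes\cdots\otimes v_m$, $\theta_R(v_1\otimes\cdots\otimes v_m)=\langle f_0,v_m\rangle v_1\otimes\cdots\otimes v_{m-1}$, and both are $0$ on $V_\mathcal{A}^0$. $W_\mathcal{A}^m=\ker(\theta_L-\theta_R)\subseteq V_\mathcal{A}^m$ for every $m\ge0$. -}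

module Defs where

open import Level using (Level)
open import Algebra.Bundles using (CommutativeRing)
open import Data.Nat using (ℕ; zero; suc)
open import Data.Fin using (Fin)
import Data.Fin as F
open import Data.List using (List; []; _∷_; _++_; length)
open import Relation.Binary.PropositionalEquality using (_≡_)

-- Everything is over a commutative ring R of scalars (ℂ in the paper),
-- with alphabet 𝒜 = Fin q and a scalar s playing the role of q^{-1/2}.
module Tensor {c ℓ : Level} (R : CommutativeRing c ℓ) (q : ℕ) (s : CommutativeRing.Carrier R) where
  open CommutativeRing R

  fromℕ : ℕ → Carrier
  fromℕ zero = 0#
  fromℕ (suc n) = 1# + fromℕ n

  Σ : ∀ {n} → (Fin n → Carrier) → Carrier
  Σ {zero} f = 0#
  Σ {suc n} f = f F.zero + Σ (λ a → f (F.suc a))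

  -- A tensor is given by its coordinate function on words:
  -- a vector of V^m is T restricted to words of length m, i.e.
  -- Σ_{|u| = m} T u · e_{u₁} ⊗ ⋯ ⊗ e_{u_m}.  Values on other lengths are ignored.
  Tensor : Set c
  Tensor = List (Fin q) → Carrier

  -- ⟨f₀, e_a⟩ = s  for every letter a
  θL : Tensor → Tensor
  θL T u = s * Σ (λ a → T (a ∷ u))

  θR : Tensor → Tensor
  θR T u = s * Σ (λ a → T (u ++ (a ∷ [])))

  iter : ℕ → (Tensor → Tensor) → Tensor → Tensor
  iter zero f T = T
  iter (suc n) f T = f (iter n f T)

  θLⁱ : ℕ → Tensor → Tensor
  θLⁱ i = iter i θL

  θRⁱ : ℕ → Tensor → Tensor
  θRⁱ j = iter j θR

  EqAt : ℕ → Tensor → Tensor → Set ℓ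
  EqAt m T T' = ∀ (u : List (Fin q)) → length u ≡ m → T u ≈ T' u

  -- T (viewed in V^m) lies in W^m = ker(θ_L - θ_R).
  -- For m = 0 both maps are 0, so the condition is vacuous (no word u has suc |u| = 0).
  InW : ℕ → Tensor → Set ℓ
  InW m T = ∀ (u : List (Fin q)) → suc (length u) ≡ m → θL T u ≈ θR T u

{-# OPTIONS --safe #-}
-- θ_L and θ_R commute, since both merely sum out one end of a word.  If
-- θ_L w = θ_R w then θ_L θ_R w = θ_R θ_L w = θ_R θ_R w, and likewise for θ_L θ_L w,
-- so θ_L and θ_R both map W^(m+1) into W^m.  On W^(m+i) this gives
-- θ_L^i = θ_R^i by induction on i, hence θ_L^i θ_R^j w = θ_R^(i+j) w depends
-- only on i + j.
module Submission where

open import Defs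
open import Algebra.Bundles using (CommutativeRing)
open import Data.Nat using (ℕ; zero; suc; _+_; _∸_; _≤_)
open import Data.Nat.Properties using (+-suc; +-assoc; +-comm; suc-injective; m+[n∸m]≡n)
open import Data.Fin as F using (Fin)
open import Data.List using ([]; _∷_; _++_; length)
open import Data.List.Properties using (length-++)
open import Data.Product using (_×_; _,_)
open import Function using (_∘_; flip)
open import Relation.Binary.PropositionalEquality
  using (_≡_; refl; cong; subst; sym; trans)
import Algebra.Properties.Semiring.Sum as SemiringSum
import Relation.Binary.Reasoning.Setoid as SetoidReasoning

module Operators {c ℓ} (R : CommutativeRing c ℓ) (q : ℕ) (s : CommutativeRing.Carrier R) where
  open CommutativeRing R
    using (Carrier; _≈_; _*_; *-congˡ; semiring; setoid)
    renaming (_+_ to _+ᵣ_; refl to ≈-refl; reflexive to ≈-reflexive; trans to ≈-trans)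
  open SemiringSum semiring using (sum; sum-cong-≋; sum-cong-≗; ∑-comm; *-distribˡ-sum)
  open SetoidReasoning setoid
  open Tensor R q s

  Σ≡sum : ∀ {n} (f : Fin n → Carrier) → Σ f ≡ sum f
  Σ≡sum {zero}  f = refl
  Σ≡sum {suc n} f = cong (f F.zero +ᵣ_) (Σ≡sum (f ∘ F.suc))

  Σ-cong : ∀ {n} {f g : Fin n → Carrier} → (∀ a → f a ≈ g a) → Σ f ≈ Σ g
  Σ-cong {f = f} {g} f≈g = begin
    Σ f   ≡⟨ Σ≡sum f ⟩
    sum f ≈⟨ sum-cong-≋ f≈g ⟩
    sum g ≡⟨ Σ≡sum g ⟨
    Σ g   ∎

  *-distribˡ-Σ : ∀ {n} x (f : Fin n → Carrier) → x * Σ f ≈ Σ (λ a → x * f a)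
  *-distribˡ-Σ x f = begin
    x * Σ f              ≡⟨ cong (x *_) (Σ≡sum f) ⟩
    x * sum f            ≈⟨ *-distribˡ-sum x f ⟩
    sum (λ a → x * f a)  ≡⟨ Σ≡sum (λ a → x * f a) ⟨
    Σ (λ a → x * f a)    ∎

  Σ-comm : ∀ {m n} (f : Fin m → Fin n → Carrier) →
           Σ (λ a → Σ (f a)) ≈ Σ (λ b → Σ (λ a → f a b))
  Σ-comm f = begin
    Σ (λ a → Σ (f a))          ≡⟨ Σ²≡sum² f ⟩
    sum (λ a → sum (f a))      ≈⟨ ∑-comm f ⟩
    sum (λ b → sum (flip f b)) ≡⟨ Σ²≡sum² (flip f) ⟨
    Σ (λ b → Σ (flip f b))     ∎
    where
    Σ²≡sum² : ∀ {m n} (g : Fin m → Fin n → Carrier) →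
              Σ (λ a → Σ (g a)) ≡ sum (λ a → sum (g a))
    Σ²≡sum² g = trans (Σ≡sum (λ a → Σ (g a))) (sum-cong-≗ (Σ≡sum ∘ g))

  θLθR≈θRθL : ∀ T u → θL (θR T) u ≈ θR (θL T) u
  θLθR≈θRθL T u = *-congˡ (begin
    Σ (λ a → s * Σ (λ b → T′ a b))  ≈⟨ Σ-cong (λ a → *-distribˡ-Σ s (T′ a)) ⟩
    Σ (λ a → Σ (λ b → s * T′ a b))  ≈⟨ Σ-comm (λ a b → s * T′ a b) ⟩
    Σ (λ b → Σ (λ a → s * T′ a b))  ≈⟨ Σ-cong (λ b → *-distribˡ-Σ s (flip T′ b)) ⟨
    Σ (λ b → s * Σ (λ a → T′ a b))  ∎)
    where
    T′ : Fin q → Fin q → Carrier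
    T′ a b = T (a ∷ u ++ b ∷ [])

  θL-cong : ∀ {m T T′} → EqAt (suc m) T T′ → EqAt m (θL T) (θL T′)
  θL-cong T≈T′ u |u|≡m = *-congˡ (Σ-cong (λ a → T≈T′ (a ∷ u) (cong suc |u|≡m)))

  θR-cong : ∀ {m T T′} → EqAt (suc m) T T′ → EqAt m (θR T) (θR T′)
  θR-cong T≈T′ u |u|≡m = *-congˡ (Σ-cong (λ a →
    T≈T′ (u ++ a ∷ []) (trans (length-++ u) (trans (+-comm (length u) 1) (cong suc |u|≡m)))))

  InW⇒θL≈θR : ∀ {m T} → InW (suc m) T → EqAt m (θL T) (θR T)
  InW⇒θL≈θR T∈W u |u|≡m = T∈W u (cong suc |u|≡m)

  InW-θL : ∀ {m T} → InW (suc m) T → InW m (θL T)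
  InW-θL {zero}  _   _ ()
  InW-θL {suc m} {T} T∈W u |u|+1≡m = ≈-trans
    (θL-cong {T = θL T} {θR T} (InW⇒θL≈θR {T = T} T∈W) u (suc-injective |u|+1≡m))
    (θLθR≈θRθL T u)

  InW-θR : ∀ {m T} → InW (suc m) T → InW m (θR T)
  InW-θR {zero}  _   _ ()
  InW-θR {suc m} {T} T∈W u |u|+1≡m = ≈-trans
    (θLθR≈θRθL T u)
    (θR-cong {T = θL T} {θR T} (InW⇒θL≈θR {T = T} T∈W) u (suc-injective |u|+1≡m))

  iter-lowersDegree : ∀ {p} (P : ℕ → Tensor → Set p) {f : Tensor → Tensor} →
                      (∀ {m T} → P (suc m) T → P m (f T)) →
                      ∀ i {m T} → P (i + m) T → P m (iter i f T)
  iter-lowersDegree P step zero    PT = PT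
  iter-lowersDegree P step (suc i) {m} {T} PT =
    step (iter-lowersDegree P step i (subst (λ n → P n T) (sym (+-suc i m)) PT))

  iter-+ : ∀ i j {f : Tensor → Tensor} T → iter i f (iter j f T) ≡ iter (i + j) f T
  iter-+ zero    j T = refl
  iter-+ (suc i) j {f} T = cong f (iter-+ i j T)

  InW-θRⁱ : ∀ j {m T} → InW (j + m) T → InW m (θRⁱ j T)
  InW-θRⁱ = iter-lowersDegree InW (λ {m} {T} → InW-θR {m} {T})

  InW-θLⁱ : ∀ i {m T} → InW (i + m) T → InW m (θLⁱ i T)
  InW-θLⁱ = iter-lowersDegree InW (λ {m} {T} → InW-θL {m} {T})

  θLⁱ≈θRⁱ : ∀ i {m T} → InW (i + m) T → EqAt m (θLⁱ i T) (θRⁱ i T)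
  θLⁱ≈θRⁱ zero    T∈W u |u|≡m = ≈-refl
  θLⁱ≈θRⁱ (suc i) {m} {T} T∈W u |u|≡m = ≈-trans
    (θL-cong {T = θLⁱ i T} {θRⁱ i T} (θLⁱ≈θRⁱ i T∈W′) u |u|≡m)
    (InW⇒θL≈θR {T = θRⁱ i T} (InW-θRⁱ i T∈W′) u |u|≡m)
    where
    T∈W′ : InW (i + suc m) T
    T∈W′ = subst (λ n → InW n T) (sym (+-suc i m)) T∈W

  InW-θRʲ-shift : ∀ i j {m T} → InW (i + j + m) T → InW (i + m) (θRⁱ j T)
  InW-θRʲ-shift i j {m} {T} T∈W =
    InW-θRⁱ j (subst (λ n → InW n T) (trans (cong (_+ m) (+-comm i j)) (+-assoc j i m)) T∈W)

  InW-θLⁱθRʲ : ∀ i j {m T} → InW (i + j + m) T → InW m (θLⁱ i (θRⁱ j T))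
  InW-θLⁱθRʲ i j T∈W = InW-θLⁱ i (InW-θRʲ-shift i j T∈W)

  θLⁱθRʲ≈θRⁱ⁺ʲ : ∀ i j {m T} → InW (i + j + m) T →
                 EqAt m (θLⁱ i (θRⁱ j T)) (θRⁱ (i + j) T)
  θLⁱθRʲ≈θRⁱ⁺ʲ i j {T = T} T∈W u |u|≡m = ≈-trans
    (θLⁱ≈θRⁱ i (InW-θRʲ-shift i j T∈W) u |u|≡m)
    (≈-reflexive (cong (λ X → X u) (iter-+ i j T)))

mainTheorem11 : ∀ {c ℓ} (R : CommutativeRing c ℓ) (q : ℕ) (s : CommutativeRing.Carrier R) →
    CommutativeRing._≈_ R (CommutativeRing._*_ R (Tensor.fromℕ R q s q) (CommutativeRing._*_ R s s)) (CommutativeRing.1# R) →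
    ∀ (k : ℕ) (w : Tensor.Tensor R q s) → 1 ≤ k → Tensor.InW R q s k w →
    (∀ (i j : ℕ) → i + j ≤ k →
      Tensor.InW R q s (k ∸ (i + j)) (Tensor.θLⁱ R q s i (Tensor.θRⁱ R q s j w)))
    ×
    (∀ (i j i′ j′ : ℕ) → i + j ≡ i′ + j′ → i + j ≤ k →
      Tensor.EqAt R q s (k ∸ (i + j))
        (Tensor.θLⁱ R q s i (Tensor.θRⁱ R q s j w))
        (Tensor.θLⁱ R q s i′ (Tensor.θRⁱ R q s j′ w)))
mainTheorem11 R q s _ k w _ w∈W =
  (λ i j i+j≤k → InW-θLⁱθRʲ i j (w∈W-split i+j≤k)) ,
  λ i j i′ j′ i+j≡i′+j′ i+j≤k u |u|≡m → begin
    θLⁱ i (θRⁱ j w) u     ≈⟨ θLⁱθRʲ≈θRⁱ⁺ʲ i j (w∈W-split i+j≤k) u |u|≡m ⟩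
    θRⁱ (i + j) w u       ≡⟨ cong (λ n → θRⁱ n w u) i+j≡i′+j′ ⟩
    θRⁱ (i′ + j′) w u     ≈⟨ θLⁱθRʲ≈θRⁱ⁺ʲ i′ j′ (w∈W-split′ i+j≡i′+j′ i+j≤k) u |u|≡m ⟨
    θLⁱ i′ (θRⁱ j′ w) u   ∎
  where
  open Tensor R q s
  open Operators R q s
  open SetoidReasoning (CommutativeRing.setoid R)

  w∈W-split : ∀ {n} → n ≤ k → InW (n + (k ∸ n)) w
  w∈W-split n≤k = subst (λ m → InW m w) (sym (m+[n∸m]≡n n≤k)) w∈W

  w∈W-split′ : ∀ {n n′} → n ≡ n′ → n ≤ k → InW (n′ + (k ∸ n)) w
  w∈W-split′ refl = w∈W-split
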